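{- Run the Level-Based Proportional Allocation algorithm for makespan (described in the context) on a fixed sequence of reported job sizes and fixed reported speeds of all machines except a machine $i^*$, in two scenarios: $i^*$ reports a speed whose power-of-2 rounding is $\bar s_{i^*}$, or a speed whose rounding is $\bar s'_{i^*}=2\bar s_{i^*}$. Let $\Lambda_j$ and $\Lambda'_j$ denote the value of $\Lambda$ at the arrival of job $j$ (before it is allocated) in the two scenarios, respectively. Then for every job $j\ge2$, $\Lambda_j\ge\Lambda'_j\ge\frac12\Lambda_j$.
   Context: Level-Based Proportional Allocation for makespan. Input: reported speeds, sorted so that $s_1\ge s_2\ge\dots\ge s_m$, and online reported job sizes $p_1,p_2,\dots$. For each $i$, let $\bar s_i$ be the largest power of $2$ (integer exponent) that is $\le s_i$. Let $K=\lfloor\log_2 m\rfloor+1$, $r_k=\bar s_1/2^{k-1}$ for $k\in[K]$, $\mathcal{M}_k=\{i:\bar s_i=r_k\}$, and $\mathcal{M}_{\le k}=\bigcup_{k'\le k}\mathcal{M}_{k'}$; machines with $\bar s_i<\bar s_1/m$ receive nothing. Job 1: $x_{i1}=1/|\mathcal{M}_1|$ for $i\in\mathcal{M}_1$; set $\Lambda\gets p_1/r_1$ and all counters $C_{i,k}\gets0$. Each later job $j$: let $k(j)=\max(\{k\in[K]:p_j\le r_k\Lambda\}\cup\{1\})$; for each $i\in\mathcal{M}_{\le k(j)}$ set $x_{ij}=\bar s_i/\sum_{t\in\mathcal{M}_{\le k(j)}}\bar s_t$ and $C_{i,k(j)}\gets C_{i,k(j)}+x_{ij}p_j/\bar s_i$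 (other $x_{ij}=0$). Then, only if $k(j)\le K-1$: if $p_j/r_1>\Lambda$, double $\Lambda$ repeatedly until $\Lambda\ge p_j/r_1$; else if $C_{1,k(j)}>\Lambda$, double $\Lambda$ once; whenever $\Lambda$ was doubled, reset all $C_{i,k}\gets0$.
   Formalization: The reported job sizes $p_1,p_2,\dots$ are taken as positive rational numbers. -}

module Defs where

open import Data.Nat as ℕ using (ℕ; zero; suc; _∸_)
open import Data.Nat.Logarithm using (⌊log₂_⌋)
open import Data.Integer as ℤ using (ℤ; +_; -[1+_]; ∣_∣)
open import Data.Fin using (Fin; zero; suc; _≟_)
open import Data.Rational as ℚ using (ℚ; 0ℚ; 1ℚ; ½; ↥_; ↧ₙ_)
open import Data.Rational.Properties as ℚP using (_≤?_; _<?_)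
open import Data.Bool using (Bool; true; false; if_then_else_)
open import Relation.Nullary using (does; yes; no)

two : ℚ
two = + 2 ℚ./ 1

pow2ℕ : ℕ → ℚ
pow2ℕ zero    = 1ℚ
pow2ℕ (suc n) = two ℚ.* pow2ℕ n

halfPow : ℕ → ℚ
halfPow zero    = 1ℚ
halfPow (suc n) = ½ ℚ.* halfPow n

pow2 : ℤ → ℚ
pow2 (+ n)      = pow2ℕ n
pow2 -[1+ n ]   = halfPow (suc n)

-- total reciprocal (only ever applied to nonzero values; 1/0 := 0 is a junk value)
inv : ℚ → ℚ
inv q with q ℚP.≟ 0ℚ
... | yes _  = 0ℚ
... | no q≢0 = ℚ.1/_ q {{ℚ.≢-nonZero q≢0}}

sumFin : (n : ℕ) → (Fin n → ℚ) → ℚ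
sumFin zero    f = 0ℚ
sumFin (suc n) f = f zero ℚ.+ sumFin n (λ i → f (suc i))

maxFin : (n : ℕ) → (Fin (suc n) → ℤ) → ℤ
maxFin zero    f = f zero
maxFin (suc n) f = f zero ℤ.⊔ maxFin n (λ i → f (suc i))

-- The instance: m = suc n machines, machine i has rounded speed
-- s̄_i = 2^(e i).  (Only the roundings s̄_i are used by the algorithm.)

module LBPA (n : ℕ) (e : Fin (suc n) → ℤ) (p : ℕ → ℚ) where

  m : ℕ
  m = suc n

  sbar : Fin m → ℚ
  sbar i = pow2 (e i)

  -- exponent of s̄_1 = max_i s̄_i (machine 1 is a fastest machine)
  emax : ℤ
  emax = maxFin n e

  sbar1 : ℚ
  sbar1 = pow2 emax

  K : ℕ
  K = ⌊log₂ m ⌋ ℕ.+ 1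

  r : ℕ → ℚ
  r k = pow2 (emax ℤ.- + (k ∸ 1))

  -- i ∈ M_{≤k}  ⇔  s̄_i = r_{k'} for some k' ≤ k  ⇔  s̄_i ≥ r_k  (as s̄_i ≤ s̄_1)
  inLevel≤ : ℕ → Fin m → Bool
  inLevel≤ k i = does (r k ≤? sbar i)

  S≤ : ℕ → ℚ
  S≤ k = sumFin m (λ t → if inLevel≤ k t then sbar t else 0ℚ)

  x : ℕ → Fin m → ℚ
  x k i = if inLevel≤ k i then sbar i ℚ.* inv (S≤ k) else 0ℚ

  -- the machine 1 of the paper (a fastest machine): its index
  -- does not matter for the value C_{1,k}, as every machine i ∈ M_{≤k}
  -- gets the same increment; we record the increment of a machine with s̄ = s̄_1.

  kSearch : ℚ → ℚ → ℕ → ℕ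
  kSearch Λ pj zero    = 1
  kSearch Λ pj (suc k) = if does (pj ≤? (r (suc k) ℚ.* Λ)) then suc k else kSearch Λ pj k

  kOf : ℚ → ℚ → ℕ
  kOf Λ pj = kSearch Λ pj K

  -- state: Λ and the counters C_{1,k} (indexed by level k)
  record State : Set where
    constructor st
    field
      Λ : ℚ
      C : ℕ → ℚ
  open State public

  zeroC : ℕ → ℚ
  zeroC _ = 0ℚ

  -- "double Λ repeatedly until Λ ≥ q": fuel-bounded loop (the fuel given
  -- below is always sufficient when Λ > 0)
  doubleUntil : ℕ → ℚ → ℚ → ℚ
  doubleUntil zero       q Λ' = Λ'
  doubleUntil (suc fuel) q Λ' =
    if does (q ≤? Λ') then Λ' else doubleUntil fuel q (two ℚ.* Λ')

  fuelFor : ℚ → ℚ → ℕ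
  fuelFor q Λ' = ∣ ↥ q ∣ ℕ.* ↧ₙ Λ'

  step : State → ℚ → State
  step (st Λ₀ C₀) pj =
    let k   = kOf Λ₀ pj
        -- C_{1,k} ← C_{1,k} + x_{1j} p_j / s̄_1
        C₁  = λ k' → if does (k' ℕ.≟ k)
                       then C₀ k' ℚ.+ (sbar1 ℚ.* inv (S≤ k)) ℚ.* pj ℚ.* pow2 (ℤ.- emax)
                       else C₀ k'
        q   = pj ℚ.* pow2 (ℤ.- emax)          -- p_j / r_1
    in if does (k ℕ.≤? (K ∸ 1))
         then (if does (Λ₀ <? q)
                 then st (doubleUntil (suc (fuelFor q Λ₀)) q Λ₀) zeroC
                 else (if does (Λ₀ <? C₁ k)
                         then st (two ℚ.* Λ₀) zeroC
                         else st Λ₀ C₁))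
         else st Λ₀ C₁

  -- jobs are numbered 1,2,3,… ; job j has size p j (p 0 is unused).
  -- stateAfter t = state after jobs 1,…,t+1 have been processed
  stateAfter : ℕ → State
  stateAfter zero    = st (p 1 ℚ.* pow2 (ℤ.- emax)) zeroC     -- Λ ← p_1 / r_1
  stateAfter (suc t) = step (stateAfter t) (p (suc (suc t)))

  -- Λ_j : value of Λ at the arrival of job j (j ≥ 2)
  LambdaAt : ℕ → ℚ
  LambdaAt j = Λ (stateAfter (j ∸ 2))

raise : {m : ℕ} → Fin m → (Fin m → ℤ) → Fin m → ℤ
raise istar e i with i ≟ istar
... | yes _ = e i ℤ.+ + 1
... | no  _ = e i

{-# OPTIONS --safe #-}
-- Measured in units of job size, the state of the algorithm is Θ = s̄₁Λ (the threshold r₁Λ of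
-- level 1; level k has threshold Θ/2^(k-1)) and the counters D_k = s̄₁C_{1,k}, which grow by
-- w_k p_j where w_k = s̄₁ / Σ_{t ∈ M_{≤k}} s̄_t is the share of the fastest machine.  In these units
-- the two scenarios run the same algorithm and differ only in w.  Raising s̄_{i*} to 2s̄_{i*} either
-- keeps s̄₁ or doubles it; in both cases one scenario U and the other V satisfy
-- w_V k ≤ w_U k and w_U (k+1) ≤ 2 w_V k.  By induction over the jobs, either Θ_U = Θ_V and V's
-- counters are below U's, or Θ_U = 2Θ_V, U's level k+1 is V's level k and D_U (k+1) ≤ 2 D_V k;
-- in particular U cannot double Λ unless V does.  Hence Θ_V ≤ Θ_U ≤ 2Θ_V throughout, which in
-- each of the two cases is the claim.

module Submission where

open import Defs
open import Data.Nat using (ℕ; suc; _≤_)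
open import Data.Integer using (ℤ)
open import Data.Fin using (Fin)
open import Data.Rational using (ℚ; 0ℚ; ½; _*_; _<_) renaming (_≤_ to _≤ℚ_)
open import Data.Product using (_×_)

open import Data.Bool using (if_then_else_)
open import Data.Empty using (⊥-elim)
open import Data.Fin as Fin using ()
open import Data.Integer as ℤ using (+_; -[1+_])
import Data.Integer.Properties as ℤP
import Data.Integer.Solver as ℤSolver
open import Data.Nat as ℕ using (zero; _∸_)
import Data.Nat.Properties as ℕP
open import Data.Product using (Σ; _,_; proj₁; proj₂)
open import Data.Rational as ℚ using (1ℚ; _+_; Positive; NonNegative; ↥_; ↧_; ↧ₙ_)
import Data.Rational.Properties as ℚP
open import Data.Rational.Solver using (module +-*-Solver)
open import Data.Rational.Unnormalised using (mkℚᵘ; *≤*) renaming (_≃_ to _≃ᵘ_; _*_ to _*ᵘ_)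
import Data.Rational.Unnormalised.Properties as ℚᵘP
open import Data.Sum using (_⊎_; inj₁; inj₂; [_,_]′)
open import Function using (_∘_)
open import Relation.Binary.PropositionalEquality
open import Relation.Nullary using (Dec; yes; no; does; ¬_)
open import Relation.Nullary.Decidable using (dec-true; dec-false)

open ℚP using (≤-refl; ≤-reflexive; ≤-trans; <⇒≤; <-≤-trans; ≤-<-trans; ≮⇒≥; ≰⇒>)

variable
  x y c : ℚ

-- Defs branches on `does (x ≤? y)`, which `with` cannot abstract since ℚ's decision procedure
-- reduces further; proofs about those definitions use these eliminators instead.
if-dec : {P A : Set} (Q : A → Set) (d : Dec P) {a b : A} →
         (P → Q a) → (¬ P → Q b) → Q (if does d then a else b)
if-dec Q (yes p) f g = f p
if-dec Q (no ¬p) f g = g ¬p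

if-dec-yes : {P A : Set} (d : Dec P) {a b : A} → P → (if does d then a else b) ≡ a
if-dec-yes d {a} {b} p = cong (λ c → if c then a else b) (dec-true d p)

if-dec-no : {P A : Set} (d : Dec P) {a b : A} → ¬ P → (if does d then a else b) ≡ b
if-dec-no d {a} {b} ¬p = cong (λ c → if c then a else b) (dec-false d ¬p)

<⇒≱ : x < y → ¬ y ≤ℚ x
<⇒≱ x<y y≤x = ℚP.<-irrefl refl (<-≤-trans x<y y≤x)

instance
  two-positive : Positive two
  two-positive = _

0<two : 0ℚ < two
0<two = ℚP.positive⁻¹ two

two*-mono-≤ : x ≤ℚ y → two * x ≤ℚ two * y
two*-mono-≤ = ℚP.*-monoˡ-≤-nonNeg two

two*-cancel-≤ : two * x ≤ℚ two * y → x ≤ℚ y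
two*-cancel-≤ = ℚP.*-cancelˡ-≤-pos two

x≤two*x : 0ℚ ≤ℚ x → x ≤ℚ two * x
x≤two*x {x} 0≤x = begin
  x            ≡⟨ ℚP.+-identityˡ x ⟨
  0ℚ + x       ≤⟨ ℚP.+-monoˡ-≤ x 0≤x ⟩
  x + x        ≡⟨ solve 1 (λ x → x :+ x := con two :* x) refl x ⟩
  two * x      ∎
  where
  open +-*-Solver
  open ℚP.≤-Reasoning

half-double : ∀ x → ½ * (two * x) ≡ x
half-double x = trans (sym (ℚP.*-assoc ½ two x)) (ℚP.*-identityˡ x)

*-pos : 0ℚ < x → 0ℚ < y → 0ℚ < x * y
*-pos {x} {y} 0<x 0<y =
  ℚP.positive⁻¹ (x * y) {{ℚP.pos*pos⇒pos x {{ℚ.positive 0<x}} y {{ℚ.positive 0<y}}}}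

*-nonneg : 0ℚ ≤ℚ x → 0ℚ ≤ℚ y → 0ℚ ≤ℚ x * y
*-nonneg {x} {y} 0≤x 0≤y =
  ℚP.nonNegative⁻¹ (x * y) {{ℚP.nonNeg*nonNeg⇒nonNeg x {{ℚ.nonNegative 0≤x}} y {{ℚ.nonNegative 0≤y}}}}

pow2ℕ-pos : ∀ n → 0ℚ < pow2ℕ n
pow2ℕ-pos zero    = ℚP.positive⁻¹ 1ℚ
pow2ℕ-pos (suc n) = *-pos 0<two (pow2ℕ-pos n)

halfPow-pos : ∀ n → 0ℚ < halfPow n
halfPow-pos zero    = ℚP.positive⁻¹ 1ℚ
halfPow-pos (suc n) = *-pos (ℚP.positive⁻¹ ½) (halfPow-pos n)

halfPow-suc-≤ : ∀ n → halfPow (suc n) ≤ℚ halfPow n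
halfPow-suc-≤ n = two*-cancel-≤ (begin
  two * (½ * halfPow n)  ≡⟨ trans (sym (ℚP.*-assoc two ½ (halfPow n))) (ℚP.*-identityˡ _) ⟩
  halfPow n              ≤⟨ x≤two*x (<⇒≤ (halfPow-pos n)) ⟩
  two * halfPow n        ∎)
  where
  open ℚP.≤-Reasoning

halfPow-antitone : ∀ {m n} → m ≤ n → halfPow n ≤ℚ halfPow m
halfPow-antitone {n = zero}  ℕ.z≤n = ≤-refl
halfPow-antitone {n = suc n} ℕ.z≤n = ≤-trans (halfPow-suc-≤ n) (halfPow-antitone {n = n} ℕ.z≤n)
halfPow-antitone (ℕ.s≤s m≤n) = ℚP.*-monoˡ-≤-nonNeg ½ (halfPow-antitone m≤n)

pow2-pos : ∀ z → 0ℚ < pow2 z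
pow2-pos (+ n)    = pow2ℕ-pos n
pow2-pos -[1+ n ] = halfPow-pos (suc n)

pow2-suc : ∀ z → pow2 (z ℤ.+ + 1) ≡ two * pow2 z
pow2-suc (+ n)            = cong pow2ℕ (ℕP.+-comm n 1)
pow2-suc -[1+ zero ]      = refl
pow2-suc -[1+ suc n ]     = sym (trans (sym (ℚP.*-assoc two ½ (halfPow (suc n)))) (ℚP.*-identityˡ _))

pow2-sub : ∀ z n → pow2 (z ℤ.- + n) ≡ halfPow n * pow2 z
pow2-sub z zero    = trans (cong pow2 (ℤP.+-identityʳ z)) (sym (ℚP.*-identityˡ (pow2 z)))
pow2-sub z (suc n) = begin-equality
  pow2 (z ℤ.- + suc n)                     ≡⟨ half-double _ ⟨
  ½ * (two * pow2 (z ℤ.- + suc n))         ≡⟨ cong (½ *_) (pow2-suc (z ℤ.- + suc n)) ⟨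
  ½ * pow2 ((z ℤ.- + suc n) ℤ.+ + 1)       ≡⟨ cong (λ w → ½ * pow2 w) (shift z (+ n)) ⟩
  ½ * pow2 (z ℤ.- + n)                     ≡⟨ cong (½ *_) (pow2-sub z n) ⟩
  ½ * (halfPow n * pow2 z)                 ≡⟨ ℚP.*-assoc ½ (halfPow n) (pow2 z) ⟨
  halfPow (suc n) * pow2 z                 ∎
  where
  open ℤSolver.+-*-Solver
  open ℚP.≤-Reasoning
  shift : ∀ z n → (z ℤ.- (+ 1 ℤ.+ n)) ℤ.+ + 1 ≡ z ℤ.- n
  shift = solve 2 (λ z n → (z :- (con (+ 1) :+ n)) :+ con (+ 1) := z :- n) refl

pow2ℕ*halfPow : ∀ n → pow2ℕ n * halfPow n ≡ 1ℚ
pow2ℕ*halfPow zero    = refl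
pow2ℕ*halfPow (suc n) = begin-equality
  (two * pow2ℕ n) * (½ * halfPow n)  ≡⟨ solve 2 (λ a b → (con two :* a) :* (con ½ :* b) := a :* b) refl (pow2ℕ n) (halfPow n) ⟩
  pow2ℕ n * halfPow n                ≡⟨ pow2ℕ*halfPow n ⟩
  1ℚ                                 ∎
  where
  open +-*-Solver
  open ℚP.≤-Reasoning

pow2*pow2-neg : ∀ z → pow2 z * pow2 (ℤ.- z) ≡ 1ℚ
pow2*pow2-neg (+ zero)  = refl
pow2*pow2-neg (+ suc n) = pow2ℕ*halfPow (suc n)
pow2*pow2-neg -[1+ n ]  = trans (ℚP.*-comm (halfPow (suc n)) (pow2ℕ (suc n))) (pow2ℕ*halfPow (suc n))

-- For Θ = s̄₁Λ, threshold Θ k is r_k Λ (Run.r*≡threshold); level is k(j) for a job of size p.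
threshold : ℚ → ℕ → ℚ
threshold Θ k = halfPow (k ∸ 1) * Θ

threshold-one : ∀ Θ → threshold Θ 1 ≡ Θ
threshold-one = ℚP.*-identityˡ

threshold-double : ∀ Θ k → 1 ≤ k → threshold (two * Θ) (suc k) ≡ threshold Θ k
threshold-double Θ (suc k) _ = solve 2 (λ h Θ → (con ½ :* h) :* (con two :* Θ) := h :* Θ) refl (halfPow k) Θ
  where
  open +-*-Solver

threshold-antitone : ∀ {Θ j k} → 0ℚ ≤ℚ Θ → j ≤ k → threshold Θ k ≤ℚ threshold Θ j
threshold-antitone {Θ} 0≤Θ j≤k =
  ℚP.*-monoʳ-≤-nonNeg Θ {{ℚ.nonNegative 0≤Θ}} (halfPow-antitone (ℕP.∸-monoˡ-≤ 1 j≤k))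

threshold-mono : ∀ {Θ Θ′} k → Θ ≤ℚ Θ′ → threshold Θ k ≤ℚ threshold Θ′ k
threshold-mono k = ℚP.*-monoˡ-≤-nonNeg (halfPow (k ∸ 1)) {{ℚ.nonNegative (<⇒≤ (halfPow-pos (k ∸ 1)))}}

search : (ℕ → ℚ) → ℚ → ℕ → ℕ
search T p zero    = 1
search T p (suc k) with p ℚP.≤? T (suc k)
... | yes _ = suc k
... | no  _ = search T p k

module _ (T : ℕ → ℚ) (p : ℚ) where

  search-≥1 : ∀ k → 1 ≤ search T p k
  search-≥1 zero = ℕP.≤-refl
  search-≥1 (suc k) with p ℚP.≤? T (suc k)
  ... | yes _ = ℕ.s≤s ℕ.z≤n
  ... | no  _ = search-≥1 k

  search-≤ : ∀ k → search T p k ≤ suc k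
  search-≤ zero = ℕP.≤-refl
  search-≤ (suc k) with p ℚP.≤? T (suc k)
  ... | yes _ = ℕP.n≤1+n (suc k)
  ... | no  _ = ℕP.m≤n⇒m≤1+n (search-≤ k)

  search-fits : ∀ k → p ≤ℚ T (search T p k) ⊎ search T p k ≡ 1
  search-fits zero = inj₂ refl
  search-fits (suc k) with p ℚP.≤? T (suc k)
  ... | yes p≤T = inj₁ p≤T
  ... | no  _   = search-fits k

  search-above : ∀ k {j} → search T p k ℕ.< j → j ≤ k → T j < p
  search-above zero    s<j j≤0 = ⊥-elim (ℕP.<⇒≱ s<j (ℕP.≤-trans j≤0 ℕ.z≤n))
  search-above (suc k) {j} s<j j≤1+k with p ℚP.≤? T (suc k) | ℕP.m≤n⇒m<n∨m≡n j≤1+k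
  ... | yes _   | _            = ⊥-elim (ℕP.<⇒≱ s<j j≤1+k)
  ... | no  p≰T | inj₂ refl    = ≰⇒> p≰T
  ... | no  _   | inj₁ j<1+k   = search-above k s<j (ℕP.≤-pred j<1+k)

  search-unique : ∀ k {c} → 1 ≤ c → c ≤ k → (p ≤ℚ T c ⊎ c ≡ 1) →
                  (∀ j → c ℕ.< j → j ≤ k → T j < p) → search T p k ≡ c
  search-unique zero    1≤c c≤0 _ _ = ⊥-elim (ℕP.<⇒≱ 1≤c c≤0)
  search-unique (suc k) {c} 1≤c c≤1+k fits above with p ℚP.≤? T (suc k) | ℕP.m≤n⇒m<n∨m≡n c≤1+k
  ... | yes _   | inj₂ refl  = refl
  ... | yes p≤T | inj₁ c<1+k = ⊥-elim (<⇒≱ (above (suc k) c<1+k ℕP.≤-refl) p≤T)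
  ... | no  p≰T | inj₂ refl  with fits
  ...   | inj₁ p≤T  = ⊥-elim (p≰T p≤T)
  ...   | inj₂ refl = refl
  search-unique (suc k) 1≤c _ fits above | no _ | inj₁ c<1+k =
    search-unique k 1≤c (ℕP.≤-pred c<1+k) fits (λ j c<j j≤k → above j c<j (ℕP.m≤n⇒m≤1+n j≤k))

  search-one : (∀ j → 2 ≤ j → T j < p) → ∀ k → search T p k ≡ 1
  search-one below zero = refl
  search-one below (suc k) with p ℚP.≤? T (suc k)
  ... | no  _   = search-one below k
  ... | yes p≤T with k
  ...   | zero   = refl
  ...   | suc _  = ⊥-elim (<⇒≱ (below _ (ℕ.s≤s (ℕ.s≤s ℕ.z≤n))) p≤T)

search-mono : ∀ {T T′} p → (∀ j → T j ≤ℚ T′ j) → ∀ k → search T p k ≤ search T′ p k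
search-mono p T≤T′ zero = ℕP.≤-refl
search-mono {T} {T′} p T≤T′ (suc k) with p ℚP.≤? T (suc k) | p ℚP.≤? T′ (suc k)
... | yes _   | yes _    = ℕP.≤-refl
... | yes p≤T | no  p≰T′ = ⊥-elim (p≰T′ (≤-trans p≤T (T≤T′ (suc k))))
... | no  _   | yes _    = search-≤ T p k
... | no  _   | no  _    = search-mono p T≤T′ k

≤∸1⇒< : ∀ {k K} → 1 ≤ k → k ≤ K ∸ 1 → k ℕ.< K
≤∸1⇒< {K = zero}  1≤k k≤0 = ⊥-elim (ℕP.<⇒≱ 1≤k k≤0)
≤∸1⇒< {K = suc K} _   k≤K = ℕ.s≤s k≤K

search-shift : ∀ {T T′} p K → (∀ j → 1 ≤ j → T′ (suc j) ≡ T j) → p ≤ℚ T 1 →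
               search T p K ≤ K ∸ 1 → search T′ p K ≡ suc (search T p K)
search-shift {T} {T′} p K shift p≤T₁ k≤ =
  search-unique T′ p K (ℕ.s≤s ℕ.z≤n) (≤∸1⇒< 1≤k k≤) (inj₁ fits) above
  where
  k : ℕ
  k = search T p K

  1≤k : 1 ≤ k
  1≤k = search-≥1 T p K

  fits : p ≤ℚ T′ (suc k)
  fits with search-fits T p K
  ... | inj₁ p≤T  = subst (p ≤ℚ_) (sym (shift k 1≤k)) p≤T
  ... | inj₂ k≡1 = subst (p ≤ℚ_) (sym (shift k 1≤k)) (subst (λ i → p ≤ℚ T i) (sym k≡1) p≤T₁)

  above : ∀ j → suc k ℕ.< j → j ≤ K → T′ j < p
  above (suc j) (ℕ.s≤s k<j) j≤K = subst (_< p) (sym (shift j (ℕP.≤-trans 1≤k (ℕP.<⇒≤ k<j))))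
    (search-above T p K k<j (ℕP.≤-trans (ℕP.n≤1+n j) j≤K))

level : ℕ → ℚ → ℚ → ℕ
level K Θ p = search (threshold Θ) p K

module _ (K : ℕ) where

  level-≥1 : ∀ Θ p → 1 ≤ level K Θ p
  level-≥1 Θ p = search-≥1 (threshold Θ) p K

  level-one : ∀ {Θ p} → 0ℚ ≤ℚ Θ → threshold Θ 2 < p → level K Θ p ≡ 1
  level-one 0≤Θ t₂<p = search-one _ _ (λ j 2≤j → ≤-<-trans (threshold-antitone 0≤Θ 2≤j) t₂<p) K

  level-mono : ∀ {Θ Θ′} p → Θ ≤ℚ Θ′ → level K Θ p ≤ level K Θ′ p
  level-mono p Θ≤Θ′ = search-mono p (λ j → threshold-mono j Θ≤Θ′) K

  level-double : ∀ {Θ p} → p ≤ℚ Θ → level K Θ p ≤ K ∸ 1 → level K (two * Θ) p ≡ suc (level K Θ p)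
  level-double {Θ} p≤Θ = search-shift _ K (threshold-double Θ) (subst (_ ≤ℚ_) (sym (threshold-one Θ)) p≤Θ)

  level-double-one : ∀ {Θ p} → 0ℚ < Θ → Θ < p → level K (two * Θ) p ≡ 1
  level-double-one {Θ} {p} 0<Θ Θ<p = level-one (<⇒≤ (*-pos 0<two 0<Θ))
    (subst (_< p) (sym (trans (threshold-double Θ 1 ℕP.≤-refl) (threshold-one Θ))) Θ<p)

  level-double-≤ : ∀ {Θ} p → 0ℚ < Θ → level K (two * Θ) p ≤ K ∸ 1 → level K Θ p ≤ K ∸ 1
  level-double-≤ p 0<Θ = ℕP.≤-trans (level-mono p (x≤two*x (<⇒≤ 0<Θ)))

-- doubleUntil of Defs, restated outside LBPA and by `with`, so that proofs can case on its test.
doubling : ℕ → ℚ → ℚ → ℚ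
doubling zero    q L = L
doubling (suc f) q L with q ℚP.≤? L
... | yes _ = L
... | no  _ = doubling f q (two * L)

doubling-stop : ∀ f {q L} → q ≤ℚ L → doubling f q L ≡ L
doubling-stop zero    q≤L = refl
doubling-stop (suc f) {q} {L} q≤L with q ℚP.≤? L
... | yes _   = refl
... | no  q≰L = ⊥-elim (q≰L q≤L)

doubling-unique : ∀ f g {q L} → q ≤ℚ doubling f q L → q ≤ℚ doubling g q L → doubling f q L ≡ doubling g q L
doubling-unique zero    g       q≤L _   = sym (doubling-stop g q≤L)
doubling-unique (suc f) zero    _   q≤L = doubling-stop (suc f) q≤L
doubling-unique (suc f) (suc g) {q} {L} reach₁ reach₂ with q ℚP.≤? L
... | yes _ = refl
... | no  _ = doubling-unique f g reach₁ reach₂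

doubling-from-double : ∀ f g {q L} → L < q → q ≤ℚ doubling f q (two * L) → q ≤ℚ doubling g q L →
                       doubling f q (two * L) ≡ doubling g q L
doubling-from-double f zero    L<q _ q≤L = ⊥-elim (<⇒≱ L<q q≤L)
doubling-from-double f (suc g) {q} {L} L<q reach₁ reach₂ with q ℚP.≤? L
... | yes q≤L = ⊥-elim (<⇒≱ L<q q≤L)
... | no  _   = doubling-unique f g reach₁ reach₂

doubling-scale : ∀ f {q L} → 0ℚ < c → c * doubling f q L ≡ doubling f (c * q) (c * L)
doubling-scale zero    0<c = refl
doubling-scale {c} (suc f) {q} {L} 0<c with q ℚP.≤? L | (c * q) ℚP.≤? (c * L)
... | yes _   | yes _     = refl
... | yes q≤L | no  cq≰cL = ⊥-elim (cq≰cL (ℚP.*-monoˡ-≤-nonNeg c {{ℚ.nonNegative (<⇒≤ 0<c)}} q≤L))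
... | no  q≰L | yes cq≤cL = ⊥-elim (q≰L (ℚP.*-cancelˡ-≤-pos c {{ℚ.positive 0<c}} cq≤cL))
... | no  _   | no  _     = trans (doubling-scale f 0<c)
                                  (cong (doubling f (c * q)) (solve 2 (λ c L → c :* (con two :* L) := con two :* (c :* L)) refl c L))
  where
  open +-*-Solver

doubling-reaches-or-stalls : ∀ f q L → q ≤ℚ doubling f q L ⊎ doubling f q L ≡ pow2ℕ f * L
doubling-reaches-or-stalls zero    q L = inj₂ (sym (ℚP.*-identityˡ L))
doubling-reaches-or-stalls (suc f) q L with q ℚP.≤? L
... | yes q≤L = inj₁ q≤L
... | no  _   with doubling-reaches-or-stalls f q (two * L)
...   | inj₁ reached = inj₁ reached
...   | inj₂ stalled = inj₂ (trans stalled (solve 2 (λ P L → P :* (con two :* L) := (con two :* P) :* L) refl (pow2ℕ f) L))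
  where
  open +-*-Solver

toℚᵘ-pow2ℕ : ∀ n → ℚ.toℚᵘ (pow2ℕ n) ≃ᵘ mkℚᵘ (+ (2 ℕ.^ n)) 0
toℚᵘ-pow2ℕ zero    = ℚᵘP.≃-refl
toℚᵘ-pow2ℕ (suc n) = ℚᵘP.≃-trans (ℚP.toℚᵘ-homo-* two (pow2ℕ n))
  (ℚᵘP.≃-trans (ℚᵘP.*-congˡ {mkℚᵘ (+ 2) 0} (toℚᵘ-pow2ℕ n))
               (ℚᵘP.≃-reflexive (cong (λ i → mkℚᵘ i 0) (sym (ℤP.pos-* 2 (2 ℕ.^ n))))))

n≤2^n : ∀ n → n ≤ 2 ℕ.^ n
n≤2^n zero    = ℕ.z≤n
n≤2^n (suc n) = ℕP.+-mono-≤ (ℕP.m^n>0 2 n) (ℕP.≤-trans (n≤2^n n) (ℕP.m≤m+n (2 ℕ.^ n) 0))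

i≤+∣i∣ : ∀ i → i ℤ.≤ + ℤ.∣ i ∣
i≤+∣i∣ (+ n)    = ℤP.≤-refl
i≤+∣i∣ -[1+ n ] = ℤ.-≤+

-- As L ≥ 1/↧L and q ≤ ∣↥q∣, we get 2^f L ≥ q once 2^f ≥ ∣↥q∣ ↧L; hence the fuel of Defs suffices.
pow2ℕ-archimedean : ∀ f q L → 0ℚ < L → ℤ.∣ ↥ q ∣ ℕ.* ↧ₙ L ≤ 2 ℕ.^ f → q ≤ℚ pow2ℕ f * L
pow2ℕ-archimedean f q@record{} L@(ℚ.mkℚ (+ suc a) d-1 _) _ bound =
  ℚP.toℚᵘ-cancel-≤ (ℚᵘP.≤-respʳ-≃ (ℚᵘP.≃-sym toℚᵘ-product) (*≤* cross))
  where
  toℚᵘ-product : ℚ.toℚᵘ (pow2ℕ f * L) ≃ᵘ mkℚᵘ (+ (2 ℕ.^ f)) 0 *ᵘ ℚ.toℚᵘ L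
  toℚᵘ-product = ℚᵘP.≃-trans (ℚP.toℚᵘ-homo-* (pow2ℕ f) L) (ℚᵘP.*-congʳ (toℚᵘ-pow2ℕ f))
  d : ℕ
  d = 1 ℕ.* suc d-1
  cross : ↥ q ℤ.* + d ℤ.≤ (+ (2 ℕ.^ f) ℤ.* + suc a) ℤ.* ↧ q
  cross = begin
    ↥ q ℤ.* + d                        ≤⟨ ℤP.*-monoʳ-≤-nonNeg (+ d) (i≤+∣i∣ (↥ q)) ⟩
    + ℤ.∣ ↥ q ∣ ℤ.* + d                ≡⟨ ℤP.pos-* ℤ.∣ ↥ q ∣ d ⟨
    + (ℤ.∣ ↥ q ∣ ℕ.* d)                ≤⟨ ℤ.+≤+ (subst (λ d → ℤ.∣ ↥ q ∣ ℕ.* d ≤ 2 ℕ.^ f)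
                                                        (sym (ℕP.*-identityˡ (suc d-1))) bound) ⟩
    + (2 ℕ.^ f)                        ≤⟨ ℤ.+≤+ (ℕP.≤-trans (ℕP.m≤m*n (2 ℕ.^ f) (suc a))
                                                           (ℕP.m≤m*n (2 ℕ.^ f ℕ.* suc a) (↧ₙ q))) ⟩
    + (2 ℕ.^ f ℕ.* suc a ℕ.* ↧ₙ q)     ≡⟨ ℤP.pos-* (2 ℕ.^ f ℕ.* suc a) (↧ₙ q) ⟩
    + (2 ℕ.^ f ℕ.* suc a) ℤ.* ↧ q      ≡⟨ cong (ℤ._* ↧ q) (ℤP.pos-* (2 ℕ.^ f) (suc a)) ⟩
    (+ (2 ℕ.^ f) ℤ.* + suc a) ℤ.* ↧ q  ∎
    where
    open ℤP.≤-Reasoning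
pow2ℕ-archimedean f q (ℚ.mkℚ (+ zero) _ _) (ℚ.*<* (ℤ.+<+ ()))
pow2ℕ-archimedean f q (ℚ.mkℚ -[1+ _ ] _ _) (ℚ.*<* ())

doubling-reaches : ∀ q L → 0ℚ < L → q ≤ℚ doubling (suc (ℤ.∣ ↥ q ∣ ℕ.* ↧ₙ L)) q L
doubling-reaches q L 0<L =
  [ (λ reached → reached) , (λ stalled → subst (q ≤ℚ_) (sym stalled) enough) ]′ (doubling-reaches-or-stalls (suc N) q L)
  where
  N : ℕ
  N = ℤ.∣ ↥ q ∣ ℕ.* ↧ₙ L
  enough : q ≤ℚ pow2ℕ (suc N) * L
  enough = pow2ℕ-archimedean (suc N) q L 0<L (ℕP.≤-trans (ℕP.n≤1+n N) (n≤2^n (suc N)))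

-- The algorithm in units of job size

addAt : (ℕ → ℚ) → ℕ → ℚ → ℕ → ℚ
addAt D k a i with i ℕ.≟ k
... | yes _ = D i + a
... | no  _ = D i

module _ {D : ℕ → ℚ} {k : ℕ} {a : ℚ} where

  addAt-here : addAt D k a k ≡ D k + a
  addAt-here with k ℕ.≟ k
  ... | yes _ = refl
  ... | no  k≢k = ⊥-elim (k≢k refl)

  addAt-other : ∀ {i} → i ≢ k → addAt D k a i ≡ D i
  addAt-other {i} i≢k with i ℕ.≟ k
  ... | yes i≡k = ⊥-elim (i≢k i≡k)
  ... | no  _   = refl

  addAt-≥ : 0ℚ ≤ℚ a → ∀ i → D i ≤ℚ addAt D k a i
  addAt-≥ 0≤a i with i ℕ.≟ k
  ... | yes _ = ≤-trans (≤-reflexive (sym (ℚP.+-identityʳ (D i)))) (ℚP.+-monoʳ-≤ (D i) 0≤a)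
  ... | no  _ = ≤-refl

addAt-mono : ∀ {D E k a b} → (∀ i → D i ≤ℚ E i) → a ≤ℚ b → ∀ i → addAt D k a i ≤ℚ addAt E k b i
addAt-mono {k = k} D≤E a≤b i with i ℕ.≟ k
... | yes _ = ℚP.+-mono-≤ (D≤E i) a≤b
... | no  _ = D≤E i

addAt-shift : ∀ {D E k a b} (P : ℕ → Set) → (∀ i → P i → E (suc i) ≤ℚ two * D i) → b ≤ℚ two * a →
              ∀ i → P i → addAt E (suc k) b (suc i) ≤ℚ two * addAt D k a i
addAt-shift {D} {E} {k} {a} {b} P E≤2D b≤2a i Pi with i ℕ.≟ k
... | yes refl = begin
  addAt E (suc i) b (suc i)  ≡⟨ addAt-here {E} {suc i} {b} ⟩
  E (suc i) + b              ≤⟨ ℚP.+-mono-≤ (E≤2D i Pi) b≤2a ⟩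
  two * D i + two * a        ≡⟨ ℚP.*-distribˡ-+ two (D i) a ⟨
  two * (D i + a)            ∎
  where
  open ℚP.≤-Reasoning
... | no  i≢k  with suc i ℕ.≟ suc k
...   | yes 1+i≡1+k = ⊥-elim (i≢k (ℕP.suc-injective 1+i≡1+k))
...   | no  _       = E≤2D i Pi

charge : ℕ → (ℕ → ℚ) → ℚ → (ℕ → ℚ) → ℚ → ℕ → ℚ
charge K w Θ D p = addAt D (level K Θ p) (w (level K Θ p) * p)

-- Θ = s̄₁Λ, D k = s̄₁C_{1,k}, and a job of size p at level k adds w k * p to D k.  New counters are
-- given pointwise (there is no function extensionality); a jump may use any fuel that reaches p,
-- since all such fuels give the same value (doubling-unique).
data Transition (K : ℕ) (w : ℕ → ℚ) (Θ : ℚ) (D : ℕ → ℚ) (p : ℚ) : ℚ → (ℕ → ℚ) → Set where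
  jump   : ∀ {D′} f → level K Θ p ≤ K ∸ 1 → Θ < p → p ≤ℚ doubling f p Θ → (∀ i → D′ i ≡ 0ℚ) →
           Transition K w Θ D p (doubling f p Θ) D′
  double : ∀ {D′} → level K Θ p ≤ K ∸ 1 → p ≤ℚ Θ → Θ < charge K w Θ D p (level K Θ p) → (∀ i → D′ i ≡ 0ℚ) →
           Transition K w Θ D p (two * Θ) D′
  stay   : ∀ {D′} → level K Θ p ≤ K ∸ 1 → p ≤ℚ Θ → charge K w Θ D p (level K Θ p) ≤ℚ Θ →
           (∀ i → D′ i ≡ charge K w Θ D p i) → Transition K w Θ D p Θ D′
  top    : ∀ {D′} → ¬ level K Θ p ≤ K ∸ 1 → (∀ i → D′ i ≡ charge K w Θ D p i) → Transition K w Θ D p Θ D′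

Valid : ℚ → (ℕ → ℚ) → Set
Valid Θ D = 0ℚ < Θ × (∀ i → 0ℚ ≤ℚ D i)

module _ {K : ℕ} {w : ℕ → ℚ} (0≤w : ∀ k → 0ℚ ≤ℚ w k) {p : ℚ} (0<p : 0ℚ < p) where

  charge-valid : ∀ {Θ D} → (∀ i → 0ℚ ≤ℚ D i) → ∀ i → 0ℚ ≤ℚ charge K w Θ D p i
  charge-valid {Θ} 0≤D i = ≤-trans (0≤D i) (addAt-≥ (*-nonneg (0≤w (level K Θ p)) (<⇒≤ 0<p)) i)

  transition-valid : ∀ {Θ D Θ′ D′} → Valid Θ D → Transition K w Θ D p Θ′ D′ → Valid Θ′ D′
  transition-valid _          (jump _ _ _ p≤Θ′ D′≡0)  = <-≤-trans 0<p p≤Θ′ , λ i → ≤-reflexive (sym (D′≡0 i))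
  transition-valid (0<Θ , _)  (double _ _ _ D′≡0)    = *-pos 0<two 0<Θ , λ i → ≤-reflexive (sym (D′≡0 i))
  transition-valid (0<Θ , 0≤D) (stay _ _ _ D′≡)     = 0<Θ , λ i → subst (0ℚ ≤ℚ_) (sym (D′≡ i)) (charge-valid 0≤D i)
  transition-valid (0<Θ , 0≤D) (top _ D′≡)          = 0<Θ , λ i → subst (0ℚ ≤ℚ_) (sym (D′≡ i)) (charge-valid 0≤D i)

-- Θ t and D t describe the state after jobs 1, …, t+1, that is, at the arrival of job t+2.
record Trajectory (K : ℕ) (w : ℕ → ℚ) (p : ℕ → ℚ) : Set where
  field
    Θ          : ℕ → ℚ
    D          : ℕ → ℕ → ℚ
    Θ-start    : Θ 0 ≡ p 1
    D-start    : ∀ i → D 0 i ≡ 0ℚ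
    transition : ∀ t → Valid (Θ t) (D t) → Transition K w (Θ t) (D t) (p (suc (suc t))) (Θ (suc t)) (D (suc t))

  valid : (∀ k → 0ℚ ≤ℚ w k) → (∀ j → 1 ≤ j → 0ℚ < p j) → ∀ t → Valid (Θ t) (D t)
  valid 0≤w 0<p zero    = subst (0ℚ <_) (sym Θ-start) (0<p 1 ℕP.≤-refl) , λ i → ≤-reflexive (sym (D-start i))
  valid 0≤w 0<p (suc t) = transition-valid 0≤w (0<p _ (ℕ.s≤s ℕ.z≤n)) (valid 0≤w 0<p t) (transition t (valid 0≤w 0<p t))

-- Coupling two runs

module Coupling (K : ℕ) (wU wV : ℕ → ℚ) (0≤wV : ∀ k → 0ℚ ≤ℚ wV k)
                (wV≤wU : ∀ k → wV k ≤ℚ wU k) (wU≤2wV : ∀ k → 1 ≤ k → wU (suc k) ≤ℚ two * wV k) where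

  Shifted : (ℕ → ℚ) → (ℕ → ℚ) → Set
  Shifted DU DV = ∀ k → 1 ≤ k × suc k ≤ K ∸ 1 → DU (suc k) ≤ℚ two * DV k

  -- even: equal thresholds and V's counters below U's.  ahead: U's threshold is twice V's, so U's level
  -- k+1 is V's level k, and there U's counter is at most twice V's (for k+1 ≤ K-1, the tested levels).
  data Coupled : ℚ → (ℕ → ℚ) → ℚ → (ℕ → ℚ) → Set where
    even  : ∀ {Θ DU DV} → (∀ k → DV k ≤ℚ DU k) → Coupled Θ DU Θ DV
    ahead : ∀ {Θ DU DV} → Shifted DU DV → Coupled (two * Θ) DU Θ DV

  even-reset : ∀ {DU DV : ℕ → ℚ} → (∀ i → 0ℚ ≤ℚ DU i) → (∀ i → DV i ≡ 0ℚ) → ∀ i → DV i ≤ℚ DU i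
  even-reset {DU} 0≤DU DV≡0 i = subst (_≤ℚ DU i) (sym (DV≡0 i)) (0≤DU i)

  ahead-reset : ∀ {DU DV : ℕ → ℚ} → (∀ i → 0ℚ ≤ℚ DV i) → (∀ i → DU i ≡ 0ℚ) → Shifted DU DV
  ahead-reset {DV = DV} 0≤DV DU≡0 k _ = subst (_≤ℚ two * DV k) (sym (DU≡0 (suc k))) (*-nonneg (<⇒≤ 0<two) (0≤DV k))

  charge-mono : ∀ Θ {p} {DU DV : ℕ → ℚ} → 0ℚ ≤ℚ p → (∀ k → DV k ≤ℚ DU k) →
                ∀ i → charge K wV Θ DV p i ≤ℚ charge K wU Θ DU p i
  charge-mono Θ {p} 0≤p DV≤DU = addAt-mono DV≤DU (ℚP.*-monoʳ-≤-nonNeg p {{ℚ.nonNegative 0≤p}} (wV≤wU (level K Θ p)))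

  even-charge : ∀ {Θ p} {DU DV DU′ DV′ : ℕ → ℚ} → 0ℚ ≤ℚ p → (∀ k → DV k ≤ℚ DU k) →
                (∀ i → DU′ i ≡ charge K wU Θ DU p i) → (∀ i → DV′ i ≡ charge K wV Θ DV p i) →
                ∀ i → DV′ i ≤ℚ DU′ i
  even-charge {Θ} 0≤p DV≤DU DU′≡ DV′≡ i =
    subst₂ _≤ℚ_ (sym (DV′≡ i)) (sym (DU′≡ i)) (charge-mono Θ 0≤p DV≤DU i)

  ahead-charge : ∀ {Θ DU DV p} → 0ℚ ≤ℚ p → p ≤ℚ Θ → level K Θ p ≤ K ∸ 1 → Shifted DU DV →
                 Shifted (charge K wU (two * Θ) DU p) (charge K wV Θ DV p)
  ahead-charge {Θ} {DU} {DV} {p} 0≤p p≤Θ k≤ DU≤2DV rewrite level-double K p≤Θ k≤ =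
    addAt-shift _ DU≤2DV (begin
      wU (suc k) * p     ≤⟨ ℚP.*-monoʳ-≤-nonNeg p {{ℚ.nonNegative 0≤p}} (wU≤2wV k (level-≥1 K Θ p)) ⟩
      two * wV k * p     ≡⟨ ℚP.*-assoc two (wV k) p ⟩
      two * (wV k * p)   ∎)
    where
    open ℚP.≤-Reasoning
    k = level K Θ p

  ahead-charge-level : ∀ {Θ DU DV p} → 0ℚ ≤ℚ p → p ≤ℚ Θ → level K Θ p ≤ K ∸ 1 → level K (two * Θ) p ≤ K ∸ 1 →
                       Shifted DU DV →
                       charge K wU (two * Θ) DU p (level K (two * Θ) p) ≤ℚ two * charge K wV Θ DV p (level K Θ p)
  ahead-charge-level {Θ} {DU} {DV} {p} 0≤p p≤Θ kV≤ kU≤ DU≤2DV = begin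
    charge K wU (two * Θ) DU p kU        ≡⟨ cong (charge K wU (two * Θ) DU p) kU≡ ⟩
    charge K wU (two * Θ) DU p (suc kV)  ≤⟨ ahead-charge 0≤p p≤Θ kV≤ DU≤2DV kV (level-≥1 K Θ p , subst (_≤ K ∸ 1) kU≡ kU≤) ⟩
    two * charge K wV Θ DV p kV          ∎
    where
    open ℚP.≤-Reasoning
    kU kV : ℕ
    kU = level K (two * Θ) p
    kV = level K Θ p
    kU≡ : kU ≡ suc kV
    kU≡ = level-double K p≤Θ kV≤

  ahead-top : ∀ {Θ p} {DU DV DU′ DV′ : ℕ → ℚ} → ¬ level K (two * Θ) p ≤ K ∸ 1 →
              (∀ i → DU′ i ≡ charge K wU (two * Θ) DU p i) → (∀ i → DV i ≤ℚ DV′ i) → Shifted DU DV → Shifted DU′ DV′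
  ahead-top {Θ} {p} {DU} {DV} {DU′} {DV′} k≰ DU′≡ DV≤DV′ DU≤2DV k (1≤k , 1+k≤) = begin
    DU′ (suc k)                         ≡⟨ DU′≡ (suc k) ⟩
    charge K wU (two * Θ) DU p (suc k)  ≡⟨ addAt-other (λ 1+k≡ → k≰ (subst (_≤ K ∸ 1) 1+k≡ 1+k≤)) ⟩
    DU (suc k)                          ≤⟨ DU≤2DV k (1≤k , 1+k≤) ⟩
    two * DV k                          ≤⟨ two*-mono-≤ (DV≤DV′ k) ⟩
    two * DV′ k                         ∎
    where
    open ℚP.≤-Reasoning

  charge-≥ : ∀ {Θ p} {DV DV′ : ℕ → ℚ} → 0ℚ < p → (∀ i → DV′ i ≡ charge K wV Θ DV p i) → ∀ i → DV i ≤ℚ DV′ i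
  charge-≥ {Θ} {p} {DV} 0<p DV′≡ i =
    subst (DV i ≤ℚ_) (sym (DV′≡ i)) (addAt-≥ (*-nonneg (0≤wV (level K Θ p)) (<⇒≤ 0<p)) i)

  ahead-resp : ∀ {DU DV EU EV} → (∀ i → DU i ≡ EU i) → (∀ i → DV i ≡ EV i) → Shifted EU EV → Shifted DU DV
  ahead-resp DU≡ DV≡ EU≤2EV k h = subst₂ (λ u v → u ≤ℚ two * v) (sym (DU≡ (suc k))) (sym (DV≡ k)) (EU≤2EV k h)

  even-step : ∀ {Θ p ΘU′ ΘV′} {DU DV DU′ DV′ : ℕ → ℚ} → 0ℚ < p → (∀ k → DV k ≤ℚ DU k) →
              Valid ΘU′ DU′ → Valid ΘV′ DV′ →
              Transition K wU Θ DU p ΘU′ DU′ → Transition K wV Θ DV p ΘV′ DV′ → Coupled ΘU′ DU′ ΘV′ DV′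
  even-step {Θ} {p} {DU′ = DU′} {DV′} _ _ (_ , 0≤DU′) _ (jump f _ _ reachU _) (jump g _ _ reachV DV′≡0) =
    subst (λ Θ′ → Coupled Θ′ DU′ (doubling g p Θ) DV′) (sym (doubling-unique f g reachU reachV))
          (even (even-reset 0≤DU′ DV′≡0))
  even-step _ _ _ _ (jump _ _ Θ<p _ _) (double _ p≤Θ _ _)   = ⊥-elim (<⇒≱ Θ<p p≤Θ)
  even-step _ _ _ _ (jump _ _ Θ<p _ _) (stay _ p≤Θ _ _)     = ⊥-elim (<⇒≱ Θ<p p≤Θ)
  even-step _ _ _ _ (jump _ k≤ _ _ _) (top k≰ _)            = ⊥-elim (k≰ k≤)
  even-step _ _ _ _ (double _ p≤Θ _ _) (jump _ _ Θ<p _ _)   = ⊥-elim (<⇒≱ Θ<p p≤Θ)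
  even-step _ _ (_ , 0≤DU′) _ (double _ _ _ _) (double _ _ _ DV′≡0) = even (even-reset 0≤DU′ DV′≡0)
  even-step _ _ _ (_ , 0≤DV′) (double _ _ _ DU′≡0) (stay _ _ _ _)   = ahead (ahead-reset 0≤DV′ DU′≡0)
  even-step _ _ _ _ (double k≤ _ _ _) (top k≰ _)            = ⊥-elim (k≰ k≤)
  even-step _ _ _ _ (stay _ p≤Θ _ _) (jump _ _ Θ<p _ _)     = ⊥-elim (<⇒≱ Θ<p p≤Θ)
  even-step {Θ} {p} 0<p DV≤DU _ _ (stay _ _ chargeU≤Θ _) (double _ _ Θ<chargeV _) =
    ⊥-elim (<⇒≱ Θ<chargeV (≤-trans (charge-mono Θ (<⇒≤ 0<p) DV≤DU (level K Θ p)) chargeU≤Θ))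
  even-step 0<p DV≤DU _ _ (stay _ _ _ DU′≡) (stay _ _ _ DV′≡) = even (even-charge (<⇒≤ 0<p) DV≤DU DU′≡ DV′≡)
  even-step _ _ _ _ (stay k≤ _ _ _) (top k≰ _)              = ⊥-elim (k≰ k≤)
  even-step _ _ _ _ (top k≰ _) (jump _ k≤ _ _ _)            = ⊥-elim (k≰ k≤)
  even-step _ _ _ _ (top k≰ _) (double k≤ _ _ _)            = ⊥-elim (k≰ k≤)
  even-step _ _ _ _ (top k≰ _) (stay k≤ _ _ _)              = ⊥-elim (k≰ k≤)
  even-step 0<p DV≤DU _ _ (top _ DU′≡) (top _ DV′≡)         = even (even-charge (<⇒≤ 0<p) DV≤DU DU′≡ DV′≡)

  ahead-step : ∀ {Θ p ΘU′ ΘV′} {DU DV DU′ DV′ : ℕ → ℚ} → 0ℚ < p → Shifted DU DV → 0ℚ < Θ →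
               Valid ΘU′ DU′ → Valid ΘV′ DV′ →
               Transition K wU (two * Θ) DU p ΘU′ DU′ → Transition K wV Θ DV p ΘV′ DV′ → Coupled ΘU′ DU′ ΘV′ DV′
  ahead-step {Θ} {p} {DU′ = DU′} {DV′} _ _ _ (_ , 0≤DU′) _ (jump f _ _ reachU _) (jump g _ Θ<p reachV DV′≡0) =
    subst (λ Θ′ → Coupled Θ′ DU′ (doubling g p Θ) DV′) (sym (doubling-from-double f g Θ<p reachU reachV))
          (even (even-reset 0≤DU′ DV′≡0))
  ahead-step _ _ 0<Θ _ _ (jump _ _ 2Θ<p _ _) (double _ p≤Θ _ _) = ⊥-elim (<⇒≱ 2Θ<p (≤-trans p≤Θ (x≤two*x (<⇒≤ 0<Θ))))
  ahead-step _ _ 0<Θ _ _ (jump _ _ 2Θ<p _ _) (stay _ p≤Θ _ _)   = ⊥-elim (<⇒≱ 2Θ<p (≤-trans p≤Θ (x≤two*x (<⇒≤ 0<Θ))))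
  ahead-step {p = p} _ _ 0<Θ _ _ (jump _ kU≤ _ _ _) (top kV≰ _)  = ⊥-elim (kV≰ (level-double-≤ K p 0<Θ kU≤))
  ahead-step {Θ} {p} {DU′ = DU′} {DV′} _ _ _ _ (_ , 0≤DV′) (double _ p≤2Θ _ DU′≡0) (jump g _ Θ<p reachV _) =
    subst (λ Θ′ → Coupled (two * Θ′) DU′ (doubling g p Θ) DV′) (sym (doubling-from-double 0 g Θ<p p≤2Θ reachV))
          (ahead (ahead-reset 0≤DV′ DU′≡0))
  ahead-step _ _ _ _ (_ , 0≤DV′) (double _ _ _ DU′≡0) (double _ _ _ _) = ahead (ahead-reset 0≤DV′ DU′≡0)
  ahead-step 0<p DU≤2DV _ _ _ (double kU≤ _ 2Θ<chargeU _) (stay kV≤ p≤Θ chargeV≤Θ _) =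
    ⊥-elim (<⇒≱ 2Θ<chargeU (≤-trans (ahead-charge-level (<⇒≤ 0<p) p≤Θ kV≤ kU≤ DU≤2DV) (two*-mono-≤ chargeV≤Θ)))
  ahead-step {p = p} _ _ 0<Θ _ _ (double kU≤ _ _ _) (top kV≰ _)  = ⊥-elim (kV≰ (level-double-≤ K p 0<Θ kU≤))
  ahead-step {Θ} {p} {DU′ = DU′} {DV′} _ _ _ (_ , 0≤DU′) _ (stay _ p≤2Θ _ _) (jump g _ Θ<p reachV DV′≡0) =
    subst (λ Θ′ → Coupled Θ′ DU′ (doubling g p Θ) DV′) (sym (doubling-from-double 0 g Θ<p p≤2Θ reachV))
          (even (even-reset 0≤DU′ DV′≡0))
  ahead-step _ _ _ (_ , 0≤DU′) _ (stay _ _ _ _) (double _ _ _ DV′≡0) = even (even-reset 0≤DU′ DV′≡0)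
  ahead-step 0<p DU≤2DV _ _ _ (stay _ _ _ DU′≡) (stay kV≤ p≤Θ _ DV′≡) =
    ahead (ahead-resp DU′≡ DV′≡ (ahead-charge (<⇒≤ 0<p) p≤Θ kV≤ DU≤2DV))
  ahead-step {p = p} _ _ 0<Θ _ _ (stay kU≤ _ _ _) (top kV≰ _)    = ⊥-elim (kV≰ (level-double-≤ K p 0<Θ kU≤))
  ahead-step {Θ} {p} _ _ 0<Θ _ _ (top kU≰ _) (jump _ kV≤ Θ<p _ _) =
    ⊥-elim (kU≰ (subst (_≤ K ∸ 1) (sym (level-double-one K 0<Θ Θ<p)) (ℕP.≤-trans (level-≥1 K Θ p) kV≤)))
  ahead-step _ _ _ (_ , 0≤DU′) _ (top _ _) (double _ _ _ DV′≡0) = even (even-reset 0≤DU′ DV′≡0)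
  ahead-step {Θ} 0<p DU≤2DV _ _ _ (top kU≰ DU′≡) (stay _ _ _ DV′≡) = ahead (ahead-top {Θ} kU≰ DU′≡ (charge-≥ 0<p DV′≡) DU≤2DV)
  ahead-step {Θ} 0<p DU≤2DV _ _ _ (top kU≰ DU′≡) (top _ DV′≡)     = ahead (ahead-top {Θ} kU≰ DU′≡ (charge-≥ 0<p DV′≡) DU≤2DV)

  coupled-step : ∀ {ΘU ΘV p ΘU′ ΘV′} {DU DV DU′ DV′ : ℕ → ℚ} → 0ℚ < p → Coupled ΘU DU ΘV DV → Valid ΘV DV →
                 Valid ΘU′ DU′ → Valid ΘV′ DV′ →
                 Transition K wU ΘU DU p ΘU′ DU′ → Transition K wV ΘV DV p ΘV′ DV′ → Coupled ΘU′ DU′ ΘV′ DV′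
  coupled-step 0<p (even DV≤DU)   _         = even-step 0<p DV≤DU
  coupled-step 0<p (ahead DU≤2DV) (0<Θ , _) = ahead-step 0<p DU≤2DV 0<Θ

  coupled-bounds : ∀ {ΘU ΘV} {DU DV : ℕ → ℚ} → 0ℚ ≤ℚ ΘV → Coupled ΘU DU ΘV DV → ΘV ≤ℚ ΘU × ΘU ≤ℚ two * ΘV
  coupled-bounds 0≤Θ (even _)  = ≤-refl , x≤two*x 0≤Θ
  coupled-bounds 0≤Θ (ahead _) = x≤two*x 0≤Θ , ≤-refl

  module _ {p : ℕ → ℚ} (U : Trajectory K wU p) (V : Trajectory K wV p) (0<p : ∀ j → 1 ≤ j → 0ℚ < p j) where
    private
      module U = Trajectory U
      module V = Trajectory V

      validU : ∀ t → Valid (U.Θ t) (U.D t)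
      validU = U.valid (λ k → ≤-trans (0≤wV k) (wV≤wU k)) 0<p
      validV : ∀ t → Valid (V.Θ t) (V.D t)
      validV = V.valid 0≤wV 0<p

    coupled : ∀ t → Coupled (U.Θ t) (U.D t) (V.Θ t) (V.D t)
    coupled zero    = subst₂ (λ ΘU ΘV → Coupled ΘU (U.D 0) ΘV (V.D 0)) (sym U.Θ-start) (sym V.Θ-start)
                        (even (λ i → ≤-reflexive (trans (V.D-start i) (sym (U.D-start i)))))
    coupled (suc t) = coupled-step (0<p _ (ℕ.s≤s ℕ.z≤n)) (coupled t) (validV t) (validU (suc t)) (validV (suc t))
                        (U.transition t (validU t)) (V.transition t (validV t))

    trajectory-bounds : ∀ t → V.Θ t ≤ℚ U.Θ t × U.Θ t ≤ℚ two * V.Θ t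
    trajectory-bounds t = coupled-bounds (<⇒≤ (proj₁ (validV t))) (coupled t)

cut : ℚ → ℚ → ℚ
cut R x = if does (R ℚP.≤? x) then x else 0ℚ

cut-nonneg : ∀ R → 0ℚ ≤ℚ x → 0ℚ ≤ℚ cut R x
cut-nonneg {x} R 0≤x = if-dec (0ℚ ≤ℚ_) (R ℚP.≤? x) (λ _ → 0≤x) (λ _ → ≤-refl)

cut-mono : ∀ R → 0ℚ ≤ℚ x → x ≤ℚ y → cut R x ≤ℚ cut R y
cut-mono {x} {y} R 0≤x x≤y = if-dec (_≤ℚ cut R y) (R ℚP.≤? x)
  (λ R≤x → subst (x ≤ℚ_) (sym (if-dec-yes (R ℚP.≤? y) (≤-trans R≤x x≤y))) x≤y)
  (λ _ → cut-nonneg R (≤-trans 0≤x x≤y))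

cut-double : ∀ R → 0ℚ ≤ℚ x → y ≤ℚ two * x → cut (two * R) y ≤ℚ two * cut R x
cut-double {x} {y} R 0≤x y≤2x = if-dec (_≤ℚ two * cut R x) (two * R ℚP.≤? y)
  (λ 2R≤y → subst (λ c → y ≤ℚ two * c) (sym (if-dec-yes (R ℚP.≤? x) (two*-cancel-≤ (≤-trans 2R≤y y≤2x)))) y≤2x)
  (λ _ → *-nonneg (<⇒≤ 0<two) (cut-nonneg R 0≤x))

-- levelSum sbar (r k) is, definitionally, S≤ k of Defs.
levelSum : ∀ {m} → (Fin m → ℚ) → ℚ → ℚ
levelSum {m} x R = sumFin m (λ t → cut R (x t))

sumFin-mono : ∀ m {f g : Fin m → ℚ} → (∀ t → f t ≤ℚ g t) → sumFin m f ≤ℚ sumFin m g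
sumFin-mono zero    f≤g = ≤-refl
sumFin-mono (suc m) f≤g = ℚP.+-mono-≤ (f≤g Fin.zero) (sumFin-mono m (λ t → f≤g (Fin.suc t)))

sumFin-* : ∀ m c (f : Fin m → ℚ) → c * sumFin m f ≡ sumFin m (λ t → c * f t)
sumFin-* zero    c f = ℚP.*-zeroʳ c
sumFin-* (suc m) c f = trans (ℚP.*-distribˡ-+ c (f Fin.zero) _)
                             (cong (λ s → c * f Fin.zero + s) (sumFin-* m c (λ t → f (Fin.suc t))))

sumFin-nonneg : ∀ m {f : Fin m → ℚ} → (∀ t → 0ℚ ≤ℚ f t) → 0ℚ ≤ℚ sumFin m f
sumFin-nonneg zero    _   = ≤-refl
sumFin-nonneg (suc m) 0≤f = ℚP.+-mono-≤ (0≤f Fin.zero) (sumFin-nonneg m (λ t → 0≤f (Fin.suc t)))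

sumFin-≥ : ∀ m {f : Fin m → ℚ} → (∀ t → 0ℚ ≤ℚ f t) → ∀ i → f i ≤ℚ sumFin m f
sumFin-≥ (suc m) {f} 0≤f Fin.zero    = begin
  f Fin.zero                          ≡⟨ ℚP.+-identityʳ (f Fin.zero) ⟨
  f Fin.zero + 0ℚ                     ≤⟨ ℚP.+-monoʳ-≤ (f Fin.zero) (sumFin-nonneg m (λ t → 0≤f (Fin.suc t))) ⟩
  sumFin (suc m) f                    ∎
  where
  open ℚP.≤-Reasoning
sumFin-≥ (suc m) {f} 0≤f (Fin.suc i) = begin
  f (Fin.suc i)                       ≤⟨ sumFin-≥ m (λ t → 0≤f (Fin.suc t)) i ⟩
  sumFin m (λ t → f (Fin.suc t))      ≡⟨ ℚP.+-identityˡ _ ⟨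
  0ℚ + sumFin m (λ t → f (Fin.suc t)) ≤⟨ ℚP.+-monoˡ-≤ _ (0≤f Fin.zero) ⟩
  sumFin (suc m) f                    ∎
  where
  open ℚP.≤-Reasoning

module _ {m : ℕ} {x y : Fin m → ℚ} (0≤x : ∀ t → 0ℚ ≤ℚ x t) where

  levelSum-mono : (∀ t → x t ≤ℚ y t) → ∀ R → levelSum x R ≤ℚ levelSum y R
  levelSum-mono x≤y R = sumFin-mono m (λ t → cut-mono R (0≤x t) (x≤y t))

  levelSum-double : (∀ t → y t ≤ℚ two * x t) → ∀ R → levelSum y (two * R) ≤ℚ two * levelSum x R
  levelSum-double y≤2x R = subst (levelSum y (two * R) ≤ℚ_) (sym (sumFin-* m two (λ t → cut R (x t))))
    (sumFin-mono m (λ t → cut-double R (0≤x t) (y≤2x t)))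

levelSum-pos : ∀ {m} {x : Fin m → ℚ} {R} → (∀ t → 0ℚ ≤ℚ x t) → ∀ i → R ≤ℚ x i → 0ℚ < x i → 0ℚ < levelSum x R
levelSum-pos {m} {x} {R} 0≤x i R≤x 0<x = <-≤-trans 0<x (subst (_≤ℚ levelSum x R) (if-dec-yes (R ℚP.≤? x i) R≤x)
  (sumFin-≥ m (λ t → cut-nonneg R (0≤x t)) i))

inv-pos : 0ℚ < x → 0ℚ < inv x
inv-pos {x} 0<x with x ℚP.≟ 0ℚ
... | yes refl = ⊥-elim (ℚP.<-irrefl refl 0<x)
... | no  _    = ℚP.positive⁻¹ _ {{ℚP.1/pos⇒pos x {{ℚ.positive 0<x}}}}

*-inv : 0ℚ < x → x * inv x ≡ 1ℚ
*-inv {x} 0<x with x ℚP.≟ 0ℚ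
... | yes refl = ⊥-elim (ℚP.<-irrefl refl 0<x)
... | no  x≢0  = ℚP.*-inverseʳ x {{ℚ.≢-nonZero x≢0}}

inv-antitone : ∀ {x y c} → 0ℚ < x → 0ℚ < y → y ≤ℚ c * x → inv x ≤ℚ c * inv y
inv-antitone {x} {y} {c} 0<x 0<y y≤cx = begin
  inv x                            ≡⟨ ℚP.*-identityˡ (inv x) ⟨
  1ℚ * inv x                       ≡⟨ cong (_* inv x) (*-inv 0<y) ⟨
  (y * inv y) * inv x              ≡⟨ ℚP.*-assoc y (inv y) (inv x) ⟩
  y * (inv y * inv x)              ≤⟨ ℚP.*-monoʳ-≤-nonNeg (inv y * inv x) {{ℚ.nonNegative 0≤y′x′}} y≤cx ⟩
  (c * x) * (inv y * inv x)        ≡⟨ solve 4 (λ c x y′ x′ → (c :* x) :* (y′ :* x′) := (c :* y′) :* (x :* x′))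
                                              refl c x (inv y) (inv x) ⟩
  (c * inv y) * (x * inv x)        ≡⟨ cong (c * inv y *_) (*-inv 0<x) ⟩
  (c * inv y) * 1ℚ                 ≡⟨ ℚP.*-identityʳ (c * inv y) ⟩
  c * inv y                        ∎
  where
  open ℚP.≤-Reasoning
  open +-*-Solver
  0≤y′x′ : 0ℚ ≤ℚ inv y * inv x
  0≤y′x′ = <⇒≤ (*-pos (inv-pos 0<y) (inv-pos 0<x))

maxFin-ub : ∀ n (f : Fin (suc n) → ℤ) i → f i ℤ.≤ maxFin n f
maxFin-ub zero    f Fin.zero    = ℤP.≤-refl
maxFin-ub (suc n) f Fin.zero    = ℤP.i≤i⊔j (f Fin.zero) _
maxFin-ub (suc n) f (Fin.suc i) = ℤP.≤-trans (maxFin-ub n (λ i → f (Fin.suc i)) i) (ℤP.i≤j⊔i (f Fin.zero) _)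

maxFin-lub : ∀ n (f : Fin (suc n) → ℤ) {c} → (∀ i → f i ℤ.≤ c) → maxFin n f ℤ.≤ c
maxFin-lub zero    f f≤c = f≤c Fin.zero
maxFin-lub (suc n) f f≤c = ℤP.⊔-lub (f≤c Fin.zero) (maxFin-lub n (λ i → f (Fin.suc i)) (λ i → f≤c (Fin.suc i)))

maxFin-attained : ∀ n (f : Fin (suc n) → ℤ) → Σ (Fin (suc n)) (λ i → maxFin n f ≡ f i)
maxFin-attained zero    f = Fin.zero , refl
maxFin-attained (suc n) f with ℤP.⊔-sel (f Fin.zero) (maxFin n (λ i → f (Fin.suc i)))
... | inj₁ max≡f₀ = Fin.zero , max≡f₀
... | inj₂ max≡rest with maxFin-attained n (λ i → f (Fin.suc i))
...   | i , rest≡fi = Fin.suc i , trans max≡rest rest≡fi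

-- The runs of LBPA

module Run (n : ℕ) (e : Fin (suc n) → ℤ) (p : ℕ → ℚ) where
  open LBPA n e p public

  0<sbar1 : 0ℚ < sbar1
  0<sbar1 = pow2-pos emax

  instance
    sbar1-positive : Positive sbar1
    sbar1-positive = ℚ.positive 0<sbar1

    sbar1-nonNegative : NonNegative sbar1
    sbar1-nonNegative = ℚP.pos⇒nonNeg sbar1

  Θ : State → ℚ
  Θ s = sbar1 * Λ s

  D : State → ℕ → ℚ
  D s k = sbar1 * C s k

  w : ℕ → ℚ
  w k = sbar1 * inv (S≤ k)

  r≡halfPow*sbar1 : ∀ k → r k ≡ halfPow (k ∸ 1) * sbar1
  r≡halfPow*sbar1 k = pow2-sub emax (k ∸ 1)

  r*≡threshold : ∀ L k → r k * L ≡ threshold (sbar1 * L) k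
  r*≡threshold L k = trans (cong (_* L) (r≡halfPow*sbar1 k)) (ℚP.*-assoc (halfPow (k ∸ 1)) sbar1 L)

  kSearch≡search : ∀ L pj k → kSearch L pj k ≡ search (threshold (sbar1 * L)) pj k
  kSearch≡search L pj zero    = refl
  kSearch≡search L pj (suc k) with pj ℚP.≤? threshold (sbar1 * L) (suc k)
  ... | yes p≤T = if-dec-yes (pj ℚP.≤? (r (suc k) * L)) (subst (pj ≤ℚ_) (sym (r*≡threshold L (suc k))) p≤T)
  ... | no  p≰T = trans (if-dec-no (pj ℚP.≤? (r (suc k) * L)) (p≰T ∘ subst (pj ≤ℚ_) (r*≡threshold L (suc k))))
                        (kSearch≡search L pj k)

  doubleUntil≡doubling : ∀ f q L → doubleUntil f q L ≡ doubling f q L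
  doubleUntil≡doubling zero    q L = refl
  doubleUntil≡doubling (suc f) q L with q ℚP.≤? L
  ... | yes q≤L = if-dec-yes (q ℚP.≤? L) q≤L
  ... | no  q≰L = trans (if-dec-no (q ℚP.≤? L) q≰L) (doubleUntil≡doubling f q (two * L))

  unscale : ∀ x → sbar1 * (x * pow2 (ℤ.- emax)) ≡ x
  unscale x = begin-equality
    sbar1 * (x * pow2 (ℤ.- emax))   ≡⟨ solve 3 (λ s x t → s :* (x :* t) := x :* (s :* t)) refl sbar1 x (pow2 (ℤ.- emax)) ⟩
    x * (sbar1 * pow2 (ℤ.- emax))   ≡⟨ cong (x *_) (pow2*pow2-neg emax) ⟩
    x * 1ℚ                          ≡⟨ ℚP.*-identityʳ x ⟩
    x                               ∎
    where
    open ℚP.≤-Reasoning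
    open +-*-Solver

  module Step (Λ₀ : ℚ) (C₀ : ℕ → ℚ) (pj : ℚ) where
    Θ₀ : ℚ
    Θ₀ = sbar1 * Λ₀

    D₀ : ℕ → ℚ
    D₀ = D (st Λ₀ C₀)

    Q : State → Set
    Q s = Transition K w Θ₀ D₀ pj (Θ s) (D s)

    k : ℕ
    k = kOf Λ₀ pj

    -- q and C₁ are copied verbatim from `step`, so that its conditionals are recognised.
    q : ℚ
    q = pj * pow2 (ℤ.- emax)

    C₁ : ℕ → ℚ
    C₁ i = if does (i ℕ.≟ k) then C₀ i + (sbar1 * inv (S≤ k)) * pj * pow2 (ℤ.- emax) else C₀ i

    k≡ : k ≡ level K Θ₀ pj
    k≡ = kSearch≡search Λ₀ pj K

    level≤ : k ≤ K ∸ 1 → level K Θ₀ pj ≤ K ∸ 1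
    level≤ = subst (_≤ K ∸ 1) k≡

    charged-at : ∀ i → sbar1 * C₁ i ≡ addAt D₀ k (w k * pj) i
    charged-at i with i ℕ.≟ k
    ... | yes i≡k = trans (cong (sbar1 *_) (if-dec-yes (i ℕ.≟ k) i≡k))
                      (trans (ℚP.*-distribˡ-+ sbar1 (C₀ i) _) (cong (λ c → sbar1 * C₀ i + c) increment))
      where
      open +-*-Solver
      open ℚP.≤-Reasoning
      increment : sbar1 * ((sbar1 * inv (S≤ k)) * pj * pow2 (ℤ.- emax)) ≡ w k * pj
      increment = begin-equality
        sbar1 * ((sbar1 * inv (S≤ k)) * pj * pow2 (ℤ.- emax))
          ≡⟨ solve 4 (λ s v x t → s :* (s :* v :* x :* t) := s :* v :* x :* (s :* t))
                     refl sbar1 (inv (S≤ k)) pj (pow2 (ℤ.- emax)) ⟩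
        w k * pj * (sbar1 * pow2 (ℤ.- emax))
          ≡⟨ cong (w k * pj *_) (pow2*pow2-neg emax) ⟩
        w k * pj * 1ℚ
          ≡⟨ ℚP.*-identityʳ (w k * pj) ⟩
        w k * pj ∎
    ... | no  i≢k = cong (sbar1 *_) (if-dec-no (i ℕ.≟ k) i≢k)

    charged : ∀ i → sbar1 * C₁ i ≡ charge K w Θ₀ D₀ pj i
    charged i = trans (charged-at i) (cong (λ l → addAt D₀ l (w l * pj) i) k≡)

    charged-level : sbar1 * C₁ k ≡ charge K w Θ₀ D₀ pj (level K Θ₀ pj)
    charged-level = trans (charged k) (cong (charge K w Θ₀ D₀ pj) k≡)

    reset : ℕ → sbar1 * 0ℚ ≡ 0ℚ
    reset _ = ℚP.*-zeroʳ sbar1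

    jumps : 0ℚ < Λ₀ → k ≤ K ∸ 1 → Λ₀ < q → Q (st (doubleUntil (suc (fuelFor q Λ₀)) q Λ₀) zeroC)
    jumps 0<Λ₀ k≤ Λ₀<q = subst (λ Θ′ → Transition K w Θ₀ D₀ pj Θ′ (λ i → sbar1 * 0ℚ)) (sym scaled)
      (jump f (level≤ k≤) (subst (Θ₀ <_) (unscale pj) (ℚP.*-monoʳ-<-pos sbar1 Λ₀<q))
            (subst (pj ≤ℚ_) scaled (subst (_≤ℚ sbar1 * doubleUntil f q Λ₀) (unscale pj)
              (ℚP.*-monoˡ-≤-nonNeg sbar1 (subst (q ≤ℚ_) (sym (doubleUntil≡doubling f q Λ₀)) (doubling-reaches q Λ₀ 0<Λ₀)))))
            reset)
      where
      f : ℕ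
      f = suc (fuelFor q Λ₀)
      scaled : sbar1 * doubleUntil f q Λ₀ ≡ doubling f pj Θ₀
      scaled = trans (cong (sbar1 *_) (doubleUntil≡doubling f q Λ₀))
                 (trans (doubling-scale f 0<sbar1) (cong (λ x → doubling f x Θ₀) (unscale pj)))

    pj≤Θ₀ : ¬ Λ₀ < q → pj ≤ℚ Θ₀
    pj≤Θ₀ Λ₀≮q = subst (_≤ℚ Θ₀) (unscale pj) (ℚP.*-monoˡ-≤-nonNeg sbar1 (≮⇒≥ Λ₀≮q))

    doubles : k ≤ K ∸ 1 → ¬ Λ₀ < q → Λ₀ < C₁ k → Q (st (two * Λ₀) zeroC)
    doubles k≤ Λ₀≮q Λ₀<C₁ = subst (λ Θ′ → Transition K w Θ₀ D₀ pj Θ′ (λ i → sbar1 * 0ℚ))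
      (solve 2 (λ s L → con two :* (s :* L) := s :* (con two :* L)) refl sbar1 Λ₀)
      (double (level≤ k≤) (pj≤Θ₀ Λ₀≮q) (subst (Θ₀ <_) charged-level (ℚP.*-monoʳ-<-pos sbar1 Λ₀<C₁)) reset)
      where
      open +-*-Solver

    stays : k ≤ K ∸ 1 → ¬ Λ₀ < q → ¬ Λ₀ < C₁ k → Q (st Λ₀ C₁)
    stays k≤ Λ₀≮q Λ₀≮C₁ = stay (level≤ k≤) (pj≤Θ₀ Λ₀≮q)
      (subst (_≤ℚ Θ₀) charged-level (ℚP.*-monoˡ-≤-nonNeg sbar1 (≮⇒≥ Λ₀≮C₁))) charged

    tops : ¬ k ≤ K ∸ 1 → Q (st Λ₀ C₁)
    tops k≰ = top (λ l≤ → k≰ (subst (_≤ K ∸ 1) (sym k≡) l≤)) charged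

  transition : ∀ s pj → 0ℚ < Λ s → Transition K w (Θ s) (D s) pj (Θ (step s pj)) (D (step s pj))
  transition (st Λ₀ C₀) pj 0<Λ₀ =
    if-dec Q (k ℕ.≤? (K ∸ 1))
      (λ k≤ → if-dec Q (Λ₀ ℚP.<? q)
        (jumps 0<Λ₀ k≤)
        (λ Λ₀≮q → if-dec Q (Λ₀ ℚP.<? C₁ k) (doubles k≤ Λ₀≮q) (stays k≤ Λ₀≮q)))
      tops
    where
    open Step Λ₀ C₀ pj

  S≤-pos : ∀ k → 0ℚ < S≤ k
  S≤-pos k with maxFin-attained n e
  ... | i₀ , emax≡ = levelSum-pos (λ t → <⇒≤ (pow2-pos (e t))) i₀ r≤sbar (pow2-pos (e i₀))
    where
    r≤sbar : r k ≤ℚ sbar i₀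
    r≤sbar = begin
      r k                         ≡⟨ r≡halfPow*sbar1 k ⟩
      halfPow (k ∸ 1) * sbar1     ≤⟨ ℚP.*-monoʳ-≤-nonNeg sbar1 (halfPow-antitone {n = k ∸ 1} ℕ.z≤n) ⟩
      1ℚ * sbar1                  ≡⟨ ℚP.*-identityˡ sbar1 ⟩
      pow2 emax                   ≡⟨ cong pow2 emax≡ ⟩
      sbar i₀                     ∎
      where
      open ℚP.≤-Reasoning

  0<w : ∀ k → 0ℚ < w k
  0<w k = *-pos 0<sbar1 (inv-pos (S≤-pos k))

  trajectory : Trajectory K w p
  trajectory = record
    { Θ          = λ t → Θ (stateAfter t)
    ; D          = λ t → D (stateAfter t)
    ; Θ-start    = unscale (p 1)
    ; D-start    = λ _ → ℚP.*-zeroʳ sbar1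
    ; transition = λ t valid → transition (stateAfter t) (p (suc (suc t))) (Λ-pos (proj₁ valid))
    }
    where
    Λ-pos : ∀ {L} → 0ℚ < sbar1 * L → 0ℚ < L
    Λ-pos {L} 0<Θ = ℚP.*-cancelˡ-<-nonNeg sbar1 (subst (_< sbar1 * L) (sym (ℚP.*-zeroʳ sbar1)) 0<Θ)

  r-halve : ∀ k → 1 ≤ k → r k ≡ two * r (suc k)
  r-halve (suc k) _ = begin-equality
    r (suc k)                          ≡⟨ r≡halfPow*sbar1 (suc k) ⟩
    halfPow k * sbar1                  ≡⟨ solve 2 (λ h s → h :* s := con two :* ((con ½ :* h) :* s)) refl (halfPow k) sbar1 ⟩
    two * (halfPow (suc k) * sbar1)    ≡⟨ cong (two *_) (r≡halfPow*sbar1 (suc (suc k))) ⟨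
    two * r (suc (suc k))              ∎
    where
    open ℚP.≤-Reasoning
    open +-*-Solver

share-antitone : ∀ {c σ S S′} → 0ℚ ≤ℚ σ → 0ℚ < S → 0ℚ < S′ → S′ ≤ℚ c * S → σ * inv S ≤ℚ c * (σ * inv S′)
share-antitone {c} {σ} {S} {S′} 0≤σ 0<S 0<S′ S′≤cS = begin
  σ * inv S              ≤⟨ ℚP.*-monoˡ-≤-nonNeg σ {{ℚ.nonNegative 0≤σ}} (inv-antitone {c = c} 0<S 0<S′ S′≤cS) ⟩
  σ * (c * inv S′)       ≡⟨ solve 3 (λ σ c v → σ :* (c :* v) := c :* (σ :* v)) refl σ c (inv S′) ⟩
  c * (σ * inv S′)       ∎
  where
  open ℚP.≤-Reasoning
  open +-*-Solver

share-antitone₁ : ∀ {σ S S′} → 0ℚ ≤ℚ σ → 0ℚ < S → 0ℚ < S′ → S′ ≤ℚ S → σ * inv S ≤ℚ σ * inv S′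
share-antitone₁ {σ} {S} {S′} 0≤σ 0<S 0<S′ S′≤S = ≤-trans
  (share-antitone {1ℚ} 0≤σ 0<S 0<S′ (subst (S′ ≤ℚ_) (sym (ℚP.*-identityˡ S)) S′≤S)) (≤-reflexive (ℚP.*-identityˡ _))

i≤j≤i+1⇒j≡i⊎j≡i+1 : ∀ {i j} → i ℤ.≤ j → j ℤ.≤ i ℤ.+ + 1 → j ≡ i ⊎ j ≡ i ℤ.+ + 1
i≤j≤i+1⇒j≡i⊎j≡i+1 {i} {j} i≤j j≤i+1 with j ℤP.≤? i
... | yes j≤i = inj₁ (ℤP.≤-antisym j≤i i≤j)
... | no  j≰i = inj₂ (ℤP.≤-antisym j≤i+1 (subst (ℤ._≤ j) (ℤP.+-comm (+ 1) i) (ℤP.i<j⇒suc[i]≤j (ℤP.≰⇒> j≰i))))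

halve : ∀ {x y} → x ≤ℚ two * y → ½ * x ≤ℚ y
halve {x} {y} x≤2y = subst (½ * x ≤ℚ_) (half-double y) (ℚP.*-monoˡ-≤-nonNeg ½ x≤2y)

-- Raising the speed of one machine

module RaisedSpeed (n : ℕ) (e : Fin (suc n) → ℤ) (istar : Fin (suc n)) (p : ℕ → ℚ) where
  module A = Run n e p
  module B = Run n (raise istar e) p

  raise-cases : ∀ i → raise istar e i ≡ e i ⊎ raise istar e i ≡ e i ℤ.+ + 1
  raise-cases i with i Fin.≟ istar
  ... | yes _ = inj₂ refl
  ... | no  _ = inj₁ refl

  sbar-bounds : ∀ t → A.sbar t ≤ℚ B.sbar t × B.sbar t ≤ℚ two * A.sbar t
  sbar-bounds t with raise-cases t
  ... | inj₁ eq = ≤-reflexive (cong pow2 (sym eq)) , ≤-trans (≤-reflexive (cong pow2 eq)) (x≤two*x (<⇒≤ (pow2-pos (e t))))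
  ... | inj₂ eq = ≤-trans (x≤two*x (<⇒≤ (pow2-pos (e t)))) (≤-reflexive (sym sbar≡)) , ≤-reflexive sbar≡
    where
    sbar≡ : B.sbar t ≡ two * A.sbar t
    sbar≡ = trans (cong pow2 eq) (pow2-suc (e t))

  emax-cases : B.emax ≡ A.emax ⊎ B.emax ≡ A.emax ℤ.+ + 1
  emax-cases = i≤j≤i+1⇒j≡i⊎j≡i+1
    (maxFin-lub n e (λ i → ℤP.≤-trans (e≤raise i) (maxFin-ub n (raise istar e) i)))
    (maxFin-lub n (raise istar e) (λ i → ℤP.≤-trans (raise≤e+1 i) (ℤP.+-monoˡ-≤ (+ 1) (maxFin-ub n e i))))
    where
    i≤i+1 : ∀ i → i ℤ.≤ i ℤ.+ + 1
    i≤i+1 i = ℤP.≤-trans (ℤP.≤-reflexive (sym (ℤP.+-identityʳ i))) (ℤP.+-monoʳ-≤ i (ℤ.+≤+ ℕ.z≤n))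
    e≤raise : ∀ i → e i ℤ.≤ raise istar e i
    e≤raise i with raise-cases i
    ... | inj₁ eq = ℤP.≤-reflexive (sym eq)
    ... | inj₂ eq = ℤP.≤-trans (i≤i+1 (e i)) (ℤP.≤-reflexive (sym eq))
    raise≤e+1 : ∀ i → raise istar e i ℤ.≤ e i ℤ.+ + 1
    raise≤e+1 i with raise-cases i
    ... | inj₁ eq = ℤP.≤-trans (ℤP.≤-reflexive eq) (i≤i+1 (e i))
    ... | inj₂ eq = ℤP.≤-reflexive eq

  0≤sbarA : ∀ t → 0ℚ ≤ℚ A.sbar t
  0≤sbarA t = <⇒≤ (pow2-pos (e t))

  ΛA ΛB : ℕ → ℚ
  ΛA t = A.Λ (A.stateAfter t)
  ΛB t = B.Λ (B.stateAfter t)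

  -- If s̄₁ is unchanged the original scenario plays U; if s̄₁ doubles, the raised one does.
  module SameTopSpeed (top≡ : B.sbar1 ≡ A.sbar1) where
    σ : ℚ
    σ = A.sbar1

    rB≡rA : ∀ k → B.r k ≡ A.r k
    rB≡rA k = trans (B.r≡halfPow*sbar1 k) (trans (cong (halfPow (k ∸ 1) *_) top≡) (sym (A.r≡halfPow*sbar1 k)))

    wB≤wA : ∀ k → B.w k ≤ℚ A.w k
    wB≤wA k = subst (λ s → s * inv (B.S≤ k) ≤ℚ A.w k) (sym top≡)
      (share-antitone₁ (<⇒≤ A.0<sbar1) (B.S≤-pos k) (A.S≤-pos k)
        (subst (λ R → A.S≤ k ≤ℚ levelSum B.sbar R) (sym (rB≡rA k))
          (levelSum-mono 0≤sbarA (λ t → proj₁ (sbar-bounds t)) (A.r k))))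

    wA≤2wB : ∀ k → 1 ≤ k → A.w (suc k) ≤ℚ two * B.w k
    wA≤2wB k 1≤k = subst (λ s → A.w (suc k) ≤ℚ two * (s * inv (B.S≤ k))) (sym top≡)
      (share-antitone {two} (<⇒≤ A.0<sbar1) (A.S≤-pos (suc k)) (B.S≤-pos k)
        (subst (λ R → levelSum B.sbar R ≤ℚ two * A.S≤ (suc k)) (sym (trans (rB≡rA k) (A.r-halve k 1≤k)))
          (levelSum-double 0≤sbarA (λ t → proj₂ (sbar-bounds t)) (A.r (suc k)))))

    open Coupling A.K A.w B.w (λ k → <⇒≤ (B.0<w k)) wB≤wA wA≤2wB

    Λ-bounds : (∀ j → 1 ≤ j → 0ℚ < p j) → ∀ t → ΛB t ≤ℚ ΛA t × ½ * ΛA t ≤ℚ ΛB t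
    Λ-bounds 0<p t = ℚP.*-cancelˡ-≤-pos σ ΘB≤ΘA , halve (ℚP.*-cancelˡ-≤-pos σ ΘA≤2ΘB)
      where
      open ℚP.≤-Reasoning
      open +-*-Solver

      bounds : B.sbar1 * ΛB t ≤ℚ σ * ΛA t × σ * ΛA t ≤ℚ two * (B.sbar1 * ΛB t)
      bounds = trajectory-bounds A.trajectory B.trajectory 0<p t

      ΘB≤ΘA : σ * ΛB t ≤ℚ σ * ΛA t
      ΘB≤ΘA = subst (λ s → s * ΛB t ≤ℚ σ * ΛA t) top≡ (proj₁ bounds)

      ΘA≤2ΘB : σ * ΛA t ≤ℚ σ * (two * ΛB t)
      ΘA≤2ΘB = begin
        σ * ΛA t               ≤⟨ proj₂ bounds ⟩
        two * (B.sbar1 * ΛB t) ≡⟨ cong (λ s → two * (s * ΛB t)) top≡ ⟩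
        two * (σ * ΛB t)       ≡⟨ solve 2 (λ s L → con two :* (s :* L) := s :* (con two :* L)) refl σ (ΛB t) ⟩
        σ * (two * ΛB t)       ∎

  module DoubledTopSpeed (top≡ : B.sbar1 ≡ two * A.sbar1) where
    σ : ℚ
    σ = A.sbar1

    rB≡2rA : ∀ k → B.r k ≡ two * A.r k
    rB≡2rA k = begin-equality
      B.r k                        ≡⟨ B.r≡halfPow*sbar1 k ⟩
      halfPow (k ∸ 1) * B.sbar1    ≡⟨ cong (halfPow (k ∸ 1) *_) top≡ ⟩
      halfPow (k ∸ 1) * (two * σ)  ≡⟨ solve 2 (λ h s → h :* (con two :* s) := con two :* (h :* s)) refl (halfPow (k ∸ 1)) σ ⟩
      two * (halfPow (k ∸ 1) * σ)  ≡⟨ cong (two *_) (A.r≡halfPow*sbar1 k) ⟨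
      two * A.r k                  ∎
      where
      open ℚP.≤-Reasoning
      open +-*-Solver

    wB≡ : ∀ k → B.w k ≡ two * (σ * inv (B.S≤ k))
    wB≡ k = trans (cong (_* inv (B.S≤ k)) top≡) (ℚP.*-assoc two σ (inv (B.S≤ k)))

    wA≤wB : ∀ k → A.w k ≤ℚ B.w k
    wA≤wB k = subst (A.w k ≤ℚ_) (sym (wB≡ k))
      (share-antitone {two} (<⇒≤ A.0<sbar1) (A.S≤-pos k) (B.S≤-pos k)
        (subst (λ R → levelSum B.sbar R ≤ℚ two * A.S≤ k) (sym (rB≡2rA k))
          (levelSum-double 0≤sbarA (λ t → proj₂ (sbar-bounds t)) (A.r k))))

    wB≤2wA : ∀ k → 1 ≤ k → B.w (suc k) ≤ℚ two * A.w k
    wB≤2wA k 1≤k = subst (_≤ℚ two * A.w k) (sym (wB≡ (suc k)))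
      (two*-mono-≤ (share-antitone₁ (<⇒≤ A.0<sbar1) (B.S≤-pos (suc k)) (A.S≤-pos k)
        (subst (λ R → A.S≤ k ≤ℚ levelSum B.sbar R) (sym (trans (rB≡2rA (suc k)) (sym (A.r-halve k 1≤k))))
          (levelSum-mono 0≤sbarA (λ t → proj₁ (sbar-bounds t)) (A.r k)))))

    open Coupling A.K B.w A.w (λ k → <⇒≤ (A.0<w k)) wA≤wB wB≤2wA

    Λ-bounds : (∀ j → 1 ≤ j → 0ℚ < p j) → ∀ t → ΛB t ≤ℚ ΛA t × ½ * ΛA t ≤ℚ ΛB t
    Λ-bounds 0<p t = two*-cancel-≤ (ℚP.*-cancelˡ-≤-pos σ 2ΘB≤2ΘA) , halve (ℚP.*-cancelˡ-≤-pos σ ΘA≤ΘB)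
      where
      open ℚP.≤-Reasoning
      open +-*-Solver

      bounds : σ * ΛA t ≤ℚ B.sbar1 * ΛB t × B.sbar1 * ΛB t ≤ℚ two * (σ * ΛA t)
      bounds = trajectory-bounds B.trajectory A.trajectory 0<p t

      swap : ∀ s L → two * (s * L) ≡ s * (two * L)
      swap = solve 2 (λ s L → con two :* (s :* L) := s :* (con two :* L)) refl

      ΘB≡ : B.sbar1 * ΛB t ≡ σ * (two * ΛB t)
      ΘB≡ = trans (cong (_* ΛB t) top≡) (trans (ℚP.*-assoc two σ (ΛB t)) (swap σ (ΛB t)))

      ΘA≤ΘB : σ * ΛA t ≤ℚ σ * (two * ΛB t)
      ΘA≤ΘB = subst (σ * ΛA t ≤ℚ_) ΘB≡ (proj₁ bounds)

      2ΘB≤2ΘA : σ * (two * ΛB t) ≤ℚ σ * (two * ΛA t)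
      2ΘB≤2ΘA = begin
        σ * (two * ΛB t)       ≡⟨ ΘB≡ ⟨
        B.sbar1 * ΛB t         ≤⟨ proj₂ bounds ⟩
        two * (σ * ΛA t)       ≡⟨ swap σ (ΛA t) ⟩
        σ * (two * ΛA t)       ∎

  Λ-bounds : (∀ j → 1 ≤ j → 0ℚ < p j) → ∀ t → ΛB t ≤ℚ ΛA t × ½ * ΛA t ≤ℚ ΛB t
  Λ-bounds = [ (λ emax≡ → SameTopSpeed.Λ-bounds (cong pow2 emax≡))
             , (λ emax≡ → DoubledTopSpeed.Λ-bounds (trans (cong pow2 emax≡) (pow2-suc A.emax))) ]′ emax-cases

lemma5 : (n : ℕ) (e : Fin (suc n) → ℤ) (istar : Fin (suc n)) (p : ℕ → ℚ) →
    (∀ j → 1 ≤ j → 0ℚ < p j) →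
    ∀ j → 2 ≤ j →
      (LBPA.LambdaAt n (raise istar e) p j ≤ℚ LBPA.LambdaAt n e p j)
      × (½ * LBPA.LambdaAt n e p j ≤ℚ LBPA.LambdaAt n (raise istar e) p j)
lemma5 n e istar p 0<p j _ = RaisedSpeed.Λ-bounds n e istar p 0<p (j ∸ 2)
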